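{- Let $m\ge1$, $n_1,\dots,n_m$ positive integers, and $k_1<\dots<k_{m-1}\le k_m$ positive integers with $k_1\le n_1$ and $k_i<k_{i-1}+n_i$ for $1<i\le m$. Let $G=H_\forall(\mathbf n,\mathbf k)$. Then $G$ is a weighted majority game if and only if one of the following holds: (1) $m=1$; (2) $m=2$ and $k_2=k_1+1$; (3) $m=2$ and $n_2=k_2-k_1+1$; (4) $k_1=n_1$ and either $m=2$, or $m=3$ and the reduced game $H_\forall((n_2,n_3),(k_2-k_1,k_3-k_1))$ falls under (2) or (3), i.e. $k_3=k_2+1$ or $n_3=k_3-k_2+1$; (5) $m\in\{2,3,4\}$, $k_m=k_{m-1}$, and the parameters $\mathbf n'=(n_1,\dots,n_{m-1})$, $\mathbf k'=(k_1,\dots,k_{m-1})$ of the $(m-1)$-level game $H_\forall(\mathbf n',\mathbf k')$ satisfy one of (1)–(4) (with $m-1$ in place of $m$).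
   Context: Submultisets of $\{1^{n_1},\dots,m^{n_m}\}$ are written $\{1^{\ell_1},\dots,m^{\ell_m}\}$ with $0\le\ell_i\le n_i$. The conjunctive hierarchical game $H_\forall(\mathbf n,\mathbf k)$, $\mathbf n=(n_1,\dots,n_m)$, $\mathbf k=(k_1,\dots,k_m)$, is the simple game on the multiset $\{1^{n_1},\dots,m^{n_m}\}$ in which $\{1^{\ell_1},\dots,m^{\ell_m}\}$ is winning iff $\ell_1+\dots+\ell_i\ge k_i$ for all $i$. A game on this multiset is a weighted majority game if there exist nonnegative weights $w_1,\dots,w_m$ and $q\ge0$ such that $\{1^{\ell_1},\dots,m^{\ell_m}\}$ is winning iff $\sum_i\ell_iw_i\ge q$.
   Formalization: In the definition of a weighted majority game, the nonnegative weights $w_1,\dots,w_m$ and the threshold $q$ are taken to be rational numbers. -}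

module Defs where

open import Data.Nat using (ℕ; zero; suc; _+_; _∸_; _≤_; _<_)
open import Data.Integer using (+_)
open import Data.Rational as ℚ using (ℚ; 0ℚ)
open import Data.Product using (_×_; Σ; ∃)
open import Data.Sum using (_⊎_)
open import Relation.Binary.PropositionalEquality using (_≡_)
open import Function.Bundles using (_⇔_)

-- Convention: levels are indexed 1..m; parameter vectors n, k and
-- coalitions ℓ are functions ℕ → ℕ of which only indices 1..m matter.

Σ₁ : (ℕ → ℕ) → ℕ → ℕ
Σ₁ f zero = 0
Σ₁ f (suc i) = Σ₁ f i + f (suc i)

Σ₁ℚ : (ℕ → ℚ) → ℕ → ℚ
Σ₁ℚ f zero = 0ℚ
Σ₁ℚ f (suc i) = Σ₁ℚ f i ℚ.+ f (suc i)

ℕ→ℚ : ℕ → ℚ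
ℕ→ℚ n = (+ n) ℚ./ 1

-- ℓ is a submultiset {1^ℓ₁,…,m^ℓₘ} of {1^n₁,…,m^nₘ}
Coalition : ℕ → (ℕ → ℕ) → (ℕ → ℕ) → Set
Coalition m n ℓ = ∀ i → 1 ≤ i → i ≤ m → ℓ i ≤ n i

WinningH∀ : ℕ → (ℕ → ℕ) → (ℕ → ℕ) → Set
WinningH∀ m k ℓ = ∀ i → 1 ≤ i → i ≤ m → k i ≤ Σ₁ ℓ i

IsWeightedMajority : (m : ℕ) → (n : ℕ → ℕ) → (Win : (ℕ → ℕ) → Set) → Set
IsWeightedMajority m n Win =
  Σ (ℕ → ℚ) λ w → Σ ℚ λ q →
    (∀ i → 1 ≤ i → i ≤ m → 0ℚ ℚ.≤ w i) × (0ℚ ℚ.≤ q) ×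
    (∀ ℓ → Coalition m n ℓ →
       (Win ℓ ⇔ (q ℚ.≤ Σ₁ℚ (λ i → ℕ→ℚ (ℓ i) ℚ.* w i) m)))

Cond1 Cond2 Cond3 Cond4 : ℕ → (ℕ → ℕ) → (ℕ → ℕ) → Set
Cond1 m n k = m ≡ 1
Cond2 m n k = m ≡ 2 × k 2 ≡ k 1 + 1
-- n₂ = k₂ − k₁ + 1 (with k₁ ≤ k₂), written without truncated subtraction
Cond3 m n k = m ≡ 2 × n 2 + k 1 ≡ k 2 + 1
Cond4 m n k = k 1 ≡ n 1 ×
  (m ≡ 2 ⊎ (m ≡ 3 × (k 3 ≡ k 2 + 1 ⊎ n 3 + k 2 ≡ k 3 + 1)))

Cond1to4 : ℕ → (ℕ → ℕ) → (ℕ → ℕ) → Set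
Cond1to4 m n k = Cond1 m n k ⊎ Cond2 m n k ⊎ Cond3 m n k ⊎ Cond4 m n k

Cond5 : ℕ → (ℕ → ℕ) → (ℕ → ℕ) → Set
Cond5 m n k = (m ≡ 2 ⊎ m ≡ 3 ⊎ m ≡ 4) × k m ≡ k (m ∸ 1) × Cond1to4 (m ∸ 1) n k

Hypotheses : ℕ → (ℕ → ℕ) → (ℕ → ℕ) → Set
Hypotheses m n k =
  1 ≤ m ×
  (∀ i → 1 ≤ i → i ≤ m → 1 ≤ n i) ×
  (∀ i → 1 ≤ i → i ≤ m → 1 ≤ k i) ×
  (∀ i → 1 ≤ i → suc i < m → k i < k (suc i)) ×
  (2 ≤ m → k (m ∸ 1) ≤ k m) ×
  k 1 ≤ n 1 ×
  (∀ i → 2 ≤ i → i ≤ m → k i < k (i ∸ 1) + n i)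

-- Necessity is a trading argument. The coalition gap k with kᵢ − kᵢ₋₁ members on level i wins with
-- all prefix sums tight; call level i flexible if it can both lose and gain a member. For flexible
-- levels i < j < l, removing a member of level i and adding one to each of levels j and l, or the
-- reverse, gives two losing coalitions C, E with C + E = 2 · gap k, which no weighting allows;
-- likewise for a flexible level followed by one that can lose and gain two members.
-- Levels 2,…,m−1 are always flexible, level 1 unless k₁ = n₁, level m unless kₘ = kₘ₋₁, and the
-- remaining configurations are exactly (1)–(5).
-- Sufficiency: explicit natural weights on the prefix sums for the two-level games of (2) and (3);
-- if k₁ = n₁ the first level gets a weight exceeding all other levels together; and a repeated
-- threshold kₘ = kₘ₋₁ imposes no new constraint.
module Submission where

open import Defs
open import Data.Nat using (ℕ; zero; suc; _+_; _*_; _∸_; _≤_; _<_; z≤n; s≤s; _≟_; _≤?_)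
import Data.Nat.Properties as ℕP
open import Data.Nat.Coprimality as Coprimality using (1-coprimeTo)
open import Data.Nat.Tactic.RingSolver using (solve-∀)
import Data.Integer as ℤ
import Data.Integer.Properties as ℤP
open import Data.Rational as ℚ using (ℚ)
import Data.Rational.Properties as ℚP
open import Data.Rational.Unnormalised as ℚᵘ using (mkℚᵘ; *≡*; *≤*)
import Data.Rational.Unnormalised.Properties as ℚᵘP
open import Data.Product using (_×_; Σ; _,_; proj₁; proj₂)
open import Data.Sum using (_⊎_; inj₁; inj₂)
open import Data.Empty using (⊥; ⊥-elim)
open import Relation.Nullary using (¬_; yes; no)
open import Relation.Binary.PropositionalEquality
  using (_≡_; _≢_; refl; sym; trans; cong; cong₂; subst; subst₂; module ≡-Reasoning)
import Relation.Binary.Reasoning.Setoid as ≈-Reasoning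
open import Function.Bundles using (_⇔_; mk⇔; Equivalence)
import Function.Properties.Equivalence as ⇔
open import Function.Properties.Equivalence using (⇔-setoid)
open import Level using (0ℓ)
open import Algebra.Bundles using (CommutativeMonoid)
import Algebra.Properties.CommutativeSemigroup as CommSemigroupProperties

open Equivalence using (to; from)

toℚᵘ-ℕ→ℚ : ∀ n → ℚ.toℚᵘ (ℕ→ℚ n) ≡ mkℚᵘ (ℤ.+ n) 0
toℚᵘ-ℕ→ℚ n = cong ℚ.toℚᵘ (ℚP.normalize-coprime (Coprimality.sym (1-coprimeTo n)))

ℕ→ℚ-homo-+ : ∀ a b → ℕ→ℚ (a + b) ≡ ℕ→ℚ a ℚ.+ ℕ→ℚ b
ℕ→ℚ-homo-+ a b = ℚP.toℚᵘ-injective (begin-equality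
  ℚ.toℚᵘ (ℕ→ℚ (a + b))                  ≡⟨ toℚᵘ-ℕ→ℚ (a + b) ⟩
  mkℚᵘ (ℤ.+ (a + b)) 0                   ≃⟨ *≡* (cong (ℤ._* ℤ.+ 1) +[a+b]≡+a*1++b*1) ⟩
  mkℚᵘ (ℤ.+ a) 0 ℚᵘ.+ mkℚᵘ (ℤ.+ b) 0    ≡⟨ sym (cong₂ ℚᵘ._+_ (toℚᵘ-ℕ→ℚ a) (toℚᵘ-ℕ→ℚ b)) ⟩
  ℚ.toℚᵘ (ℕ→ℚ a) ℚᵘ.+ ℚ.toℚᵘ (ℕ→ℚ b)    ≃⟨ ℚP.toℚᵘ-homo-+ (ℕ→ℚ a) (ℕ→ℚ b) ⟨
  ℚ.toℚᵘ (ℕ→ℚ a ℚ.+ ℕ→ℚ b)              ∎)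
  where
  open ℚᵘP.≤-Reasoning
  +[a+b]≡+a*1++b*1 : ℤ.+ (a + b) ≡ ℤ.+ a ℤ.* ℤ.+ 1 ℤ.+ ℤ.+ b ℤ.* ℤ.+ 1
  +[a+b]≡+a*1++b*1 =
    trans (ℤP.pos-+ a b) (sym (cong₂ ℤ._+_ (ℤP.*-identityʳ (ℤ.+ a)) (ℤP.*-identityʳ (ℤ.+ b))))

ℕ→ℚ-homo-* : ∀ a b → ℕ→ℚ (a * b) ≡ ℕ→ℚ a ℚ.* ℕ→ℚ b
ℕ→ℚ-homo-* a b = ℚP.toℚᵘ-injective (begin-equality
  ℚ.toℚᵘ (ℕ→ℚ (a * b))                  ≡⟨ toℚᵘ-ℕ→ℚ (a * b) ⟩
  mkℚᵘ (ℤ.+ (a * b)) 0                   ≃⟨ *≡* (cong (ℤ._* ℤ.+ 1) (ℤP.pos-* a b)) ⟩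
  mkℚᵘ (ℤ.+ a) 0 ℚᵘ.* mkℚᵘ (ℤ.+ b) 0    ≡⟨ sym (cong₂ ℚᵘ._*_ (toℚᵘ-ℕ→ℚ a) (toℚᵘ-ℕ→ℚ b)) ⟩
  ℚ.toℚᵘ (ℕ→ℚ a) ℚᵘ.* ℚ.toℚᵘ (ℕ→ℚ b)    ≃⟨ ℚP.toℚᵘ-homo-* (ℕ→ℚ a) (ℕ→ℚ b) ⟨
  ℚ.toℚᵘ (ℕ→ℚ a ℚ.* ℕ→ℚ b)              ∎)
  where open ℚᵘP.≤-Reasoning

ℕ→ℚ-mono-≤ : ∀ {a b} → a ≤ b → ℕ→ℚ a ℚ.≤ ℕ→ℚ b
ℕ→ℚ-mono-≤ {a} {b} a≤b = ℚP.toℚᵘ-cancel-≤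
  (subst₂ ℚᵘ._≤_ (sym (toℚᵘ-ℕ→ℚ a)) (sym (toℚᵘ-ℕ→ℚ b))
    (*≤* (ℤP.*-monoʳ-≤-nonNeg (ℤ.+ 1) (ℤ.+≤+ a≤b))))

ℕ→ℚ-cancel-≤ : ∀ {a b} → ℕ→ℚ a ℚ.≤ ℕ→ℚ b → a ≤ b
ℕ→ℚ-cancel-≤ {a} {b} le with subst₂ ℚᵘ._≤_ (toℚᵘ-ℕ→ℚ a) (toℚᵘ-ℕ→ℚ b) (ℚP.toℚᵘ-mono-≤ le)
... | *≤* a*1≤b*1 = ℤP.drop‿+≤+ (ℤP.*-cancelʳ-≤-pos (ℤ.+ a) (ℤ.+ b) (ℤ.+ 1) a*1≤b*1)

module _ where
  open CommSemigroupProperties ℕP.+-commutativeSemigroup using (interchange)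

  Σ₁-cong : ∀ {f g} s → (∀ t → 1 ≤ t → t ≤ s → f t ≡ g t) → Σ₁ f s ≡ Σ₁ g s
  Σ₁-cong zero    f≡g = refl
  Σ₁-cong (suc s) f≡g =
    cong₂ _+_ (Σ₁-cong s λ t 1≤t t≤s → f≡g t 1≤t (ℕP.m≤n⇒m≤1+n t≤s)) (f≡g (suc s) (s≤s z≤n) ℕP.≤-refl)

  Σ₁-+ : ∀ f g s → Σ₁ (λ t → f t + g t) s ≡ Σ₁ f s + Σ₁ g s
  Σ₁-+ f g zero    = refl
  Σ₁-+ f g (suc s) = trans (cong (_+ (f (suc s) + g (suc s))) (Σ₁-+ f g s))
                           (interchange (Σ₁ f s) (Σ₁ g s) (f (suc s)) (g (suc s)))

Σ₁-mono-≤ : ∀ {f g} s → (∀ t → 1 ≤ t → t ≤ s → f t ≤ g t) → Σ₁ f s ≤ Σ₁ g s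
Σ₁-mono-≤ zero    f≤g = z≤n
Σ₁-mono-≤ (suc s) f≤g =
  ℕP.+-mono-≤ (Σ₁-mono-≤ s λ t 1≤t t≤s → f≤g t 1≤t (ℕP.m≤n⇒m≤1+n t≤s)) (f≤g (suc s) (s≤s z≤n) ℕP.≤-refl)

Σ₁-∸ : ∀ f g s → (∀ t → 1 ≤ t → t ≤ s → g t ≤ f t) → Σ₁ (λ t → f t ∸ g t) s + Σ₁ g s ≡ Σ₁ f s
Σ₁-∸ f g s g≤f = trans (sym (Σ₁-+ (λ t → f t ∸ g t) g s))
                       (Σ₁-cong s λ t 1≤t t≤s → ℕP.m∸n+n≡m (g≤f t 1≤t t≤s))

Σ₁-suc : ∀ f s → Σ₁ f (suc s) ≡ f 1 + Σ₁ (λ t → f (suc t)) s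
Σ₁-suc f zero    = sym (ℕP.+-identityʳ (f 1))
Σ₁-suc f (suc s) = trans (cong (_+ f (2 + s)) (Σ₁-suc f s)) (ℕP.+-assoc (f 1) _ (f (2 + s)))

module _ where
  open CommSemigroupProperties (CommutativeMonoid.commutativeSemigroup ℚP.+-0-commutativeMonoid)
    using (interchange)

  Σ₁ℚ-cong : ∀ {f g} s → (∀ t → 1 ≤ t → t ≤ s → f t ≡ g t) → Σ₁ℚ f s ≡ Σ₁ℚ g s
  Σ₁ℚ-cong zero    f≡g = refl
  Σ₁ℚ-cong (suc s) f≡g =
    cong₂ ℚ._+_ (Σ₁ℚ-cong s λ t 1≤t t≤s → f≡g t 1≤t (ℕP.m≤n⇒m≤1+n t≤s)) (f≡g (suc s) (s≤s z≤n) ℕP.≤-refl)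

  Σ₁ℚ-+ : ∀ f g s → Σ₁ℚ (λ t → f t ℚ.+ g t) s ≡ Σ₁ℚ f s ℚ.+ Σ₁ℚ g s
  Σ₁ℚ-+ f g zero    = refl
  Σ₁ℚ-+ f g (suc s) = trans (cong (ℚ._+ (f (suc s) ℚ.+ g (suc s))) (Σ₁ℚ-+ f g s))
                            (interchange (Σ₁ℚ f s) (Σ₁ℚ g s) (f (suc s)) (g (suc s)))

Σ₁ℚ-ℕ→ℚ : ∀ (ℓ w : ℕ → ℕ) s → Σ₁ℚ (λ i → ℕ→ℚ (ℓ i) ℚ.* ℕ→ℚ (w i)) s ≡ ℕ→ℚ (Σ₁ (λ i → ℓ i * w i) s)
Σ₁ℚ-ℕ→ℚ ℓ w zero    = refl
Σ₁ℚ-ℕ→ℚ ℓ w (suc s) =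
  trans (cong₂ ℚ._+_ (Σ₁ℚ-ℕ→ℚ ℓ w s) (sym (ℕ→ℚ-homo-* (ℓ (suc s)) (w (suc s)))))
        (sym (ℕ→ℚ-homo-+ (Σ₁ (λ i → ℓ i * w i) s) (ℓ (suc s) * w (suc s))))

-- Weighted games

IsNatWeighted : (m : ℕ) → (n : ℕ → ℕ) → (Win : (ℕ → ℕ) → Set) → Set
IsNatWeighted m n Win = Σ (ℕ → ℕ) λ w → Σ ℕ λ q →
  ∀ ℓ → Coalition m n ℓ → (Win ℓ ⇔ (q ≤ Σ₁ (λ i → ℓ i * w i) m))

isNatWeighted⇒isWeightedMajority : ∀ {m n Win} → IsNatWeighted m n Win → IsWeightedMajority m n Win
isNatWeighted⇒isWeightedMajority {m} (w , q , represents) =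
  (λ i → ℕ→ℚ (w i)) , ℕ→ℚ q , (λ i _ _ → ℕ→ℚ-mono-≤ (z≤n {w i})) , ℕ→ℚ-mono-≤ (z≤n {q}) ,
  λ ℓ ℓ-coalition → let weight≡ = Σ₁ℚ-ℕ→ℚ ℓ w m in mk⇔
    (λ win → subst (ℕ→ℚ q ℚ.≤_) (sym weight≡) (ℕ→ℚ-mono-≤ (to (represents ℓ ℓ-coalition) win)))
    (λ q≤weight → from (represents ℓ ℓ-coalition) (ℕ→ℚ-cancel-≤ (subst (ℕ→ℚ q ℚ.≤_) weight≡ q≤weight)))

-- 2 w(D) = w(C) + w(E), while w(D) ≥ q > w(C), w(E).
isWeightedMajority⇒tradeRobust : ∀ {m n Win} → IsWeightedMajority m n Win →
  ∀ {D C E} → Coalition m n D → Coalition m n C → Coalition m n E →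
  (∀ i → 1 ≤ i → i ≤ m → D i + D i ≡ C i + E i) →
  Win D → ¬ Win C → ¬ Win E → ⊥
isWeightedMajority⇒tradeRobust {m} {n} {Win} (w , q , _ , _ , represents) {D} {C} {E}
  D-coalition C-coalition E-coalition D+D≡C+E D-wins C-loses E-loses =
  ℚP.<-irrefl balance (ℚP.<-≤-trans (ℚP.+-mono-< (below C-coalition C-loses) (below E-coalition E-loses))
                                     (ℚP.+-mono-≤ D-above D-above))
  where
  term : (ℕ → ℕ) → ℕ → ℚ
  term X i = ℕ→ℚ (X i) ℚ.* w i
  weight : (ℕ → ℕ) → ℚ
  weight X = Σ₁ℚ (term X) m
  D-above : q ℚ.≤ weight D
  D-above = to (represents D D-coalition) D-wins
  below : ∀ {X} → Coalition m n X → ¬ Win X → weight X ℚ.< q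
  below X-coalition X-loses = ℚP.≰⇒> (λ q≤weight → X-loses (from (represents _ X-coalition) q≤weight))
  term-balance : ∀ i → 1 ≤ i → i ≤ m → term D i ℚ.+ term D i ≡ term C i ℚ.+ term E i
  term-balance i 1≤i i≤m = begin
    term D i ℚ.+ term D i               ≡⟨ ℚP.*-distribʳ-+ (w i) (ℕ→ℚ (D i)) (ℕ→ℚ (D i)) ⟨
    (ℕ→ℚ (D i) ℚ.+ ℕ→ℚ (D i)) ℚ.* w i  ≡⟨ cong (ℚ._* w i) (ℕ→ℚ-homo-+ (D i) (D i)) ⟨
    ℕ→ℚ (D i + D i) ℚ.* w i             ≡⟨ cong (λ x → ℕ→ℚ x ℚ.* w i) (D+D≡C+E i 1≤i i≤m) ⟩
    ℕ→ℚ (C i + E i) ℚ.* w i             ≡⟨ cong (ℚ._* w i) (ℕ→ℚ-homo-+ (C i) (E i)) ⟩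
    (ℕ→ℚ (C i) ℚ.+ ℕ→ℚ (E i)) ℚ.* w i  ≡⟨ ℚP.*-distribʳ-+ (w i) (ℕ→ℚ (C i)) (ℕ→ℚ (E i)) ⟩
    term C i ℚ.+ term E i               ∎
    where open ≡-Reasoning
  balance : weight C ℚ.+ weight E ≡ weight D ℚ.+ weight D
  balance = begin
    weight C ℚ.+ weight E                         ≡⟨ Σ₁ℚ-+ (term C) (term E) m ⟨
    Σ₁ℚ (λ i → term C i ℚ.+ term E i) m           ≡⟨ Σ₁ℚ-cong m (λ i 1≤i i≤m → sym (term-balance i 1≤i i≤m)) ⟩
    Σ₁ℚ (λ i → term D i ℚ.+ term D i) m           ≡⟨ Σ₁ℚ-+ (term D) (term D) m ⟩
    weight D ℚ.+ weight D                         ∎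
    where open ≡-Reasoning

-- Necessity

-- The functions ℕ → ℕ of the statement carry a junk value at index 0; withK₀ k resets it to k₀ = 0.
withK₀ : (ℕ → ℕ) → ℕ → ℕ
withK₀ k zero    = 0
withK₀ k (suc i) = k (suc i)

gap : (ℕ → ℕ) → ℕ → ℕ
gap k zero    = 0
gap k (suc i) = k (suc i) ∸ withK₀ k i

Nondecreasing : ℕ → (ℕ → ℕ) → Set
Nondecreasing m k = ∀ t → suc t ≤ m → withK₀ k t ≤ k (suc t)

Σ₁-gap : ∀ {m k} → Nondecreasing m k → ∀ t → t ≤ m → Σ₁ (gap k) t ≡ withK₀ k t
Σ₁-gap nondecreasing zero    _   = refl
Σ₁-gap {k = k} nondecreasing (suc t) t<m =
  trans (cong (_+ gap k (suc t)) (Σ₁-gap nondecreasing t (ℕP.<⇒≤ t<m))) (ℕP.m+[n∸m]≡n (nondecreasing t t<m))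

unitAt : ℕ → ℕ → ℕ
unitAt i t with t ≟ i
... | yes _ = 1
... | no  _ = 0

unitAt-self : ∀ i → unitAt i i ≡ 1
unitAt-self i with i ≟ i
... | yes _   = refl
... | no  i≢i = ⊥-elim (i≢i refl)

unitAt-≢ : ∀ {i t} → t ≢ i → unitAt i t ≡ 0
unitAt-≢ {i} {t} t≢i with t ≟ i
... | yes t≡i = ⊥-elim (t≢i t≡i)
... | no  _   = refl

Σ₁-unitAt-< : ∀ {i s} → s < i → Σ₁ (unitAt i) s ≡ 0
Σ₁-unitAt-< {s = zero}  _   = refl
Σ₁-unitAt-< {i} {suc s} s<i =
  cong₂ _+_ (Σ₁-unitAt-< {i} (ℕP.<⇒≤ s<i)) (unitAt-≢ λ s≡i → ℕP.<-irrefl s≡i s<i)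

Σ₁-unitAt-≥ : ∀ {i s} → 1 ≤ i → i ≤ s → Σ₁ (unitAt i) s ≡ 1
Σ₁-unitAt-≥ {s = zero}  (s≤s _) ()
Σ₁-unitAt-≥ {i} {suc s} 1≤i i≤s with i ≟ suc s
... | yes refl = cong₂ _+_ (Σ₁-unitAt-< {i} ℕP.≤-refl) (unitAt-self i)
... | no  i≢s  = cong₂ _+_ (Σ₁-unitAt-≥ 1≤i (ℕP.≤-pred (ℕP.≤∧≢⇒< i≤s i≢s))) (unitAt-≢ (λ s≡i → i≢s (sym s≡i)))

-- On level t, the coalition gap k can both lose x members and gain x members.
Admissible : (ℕ → ℕ) → (ℕ → ℕ) → ℕ → ℕ → Set
Admissible n k x t = x ≤ gap k t × x + gap k t ≤ n t

Flexible DoublyFlexible : (ℕ → ℕ) → (ℕ → ℕ) → ℕ → Set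
Flexible n k = Admissible n k 1
DoublyFlexible n k = Admissible n k 2

unitAt-admissible : ∀ {n k i t} → Flexible n k i → gap k t ≤ n t → Admissible n k (unitAt i t) t
unitAt-admissible {i = i} {t} flexible gap≤n with t ≟ i
... | yes refl = flexible
... | no  _    = z≤n , gap≤n

unitAt+unitAt-admissible : ∀ {n k j l t} → j < l → Flexible n k j → Flexible n k l → gap k t ≤ n t →
  Admissible n k (unitAt j t + unitAt l t) t
unitAt+unitAt-admissible {j = j} {l} {t} j<l flexible-j flexible-l gap≤n with t ≟ j | t ≟ l
... | yes refl | yes refl = ⊥-elim (ℕP.<-irrefl refl j<l)
... | yes refl | no  _    = flexible-j
... | no  _    | yes refl = flexible-l
... | no  _    | no  _    = z≤n , gap≤n

2×unitAt-admissible : ∀ {n k j t} → DoublyFlexible n k j → gap k t ≤ n t →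
  Admissible n k (unitAt j t + unitAt j t) t
2×unitAt-admissible {j = j} {t} doubly-flexible gap≤n with t ≟ j
... | yes refl = doubly-flexible
... | no  _    = z≤n , gap≤n

∸-balanced : ∀ {a b d} → a ≤ d → b ≤ d → d + d ≡ (b + d ∸ a) + (a + d ∸ b)
∸-balanced {a} {b} {d} a≤d b≤d = sym (begin
  (b + d ∸ a) + (a + d ∸ b)        ≡⟨ cong₂ _+_ (ℕP.+-∸-assoc b a≤d) (ℕP.+-∸-assoc a b≤d) ⟩
  (b + (d ∸ a)) + (a + (d ∸ b))    ≡⟨ regroup b (d ∸ a) a (d ∸ b) ⟩
  (d ∸ a + a) + (d ∸ b + b)        ≡⟨ cong₂ _+_ (ℕP.m∸n+n≡m a≤d) (ℕP.m∸n+n≡m b≤d) ⟩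
  d + d                            ∎)
  where
  open ≡-Reasoning
  regroup : ∀ w x y z → (w + x) + (y + z) ≡ (x + y) + (z + w)
  regroup = solve-∀

-- The prefix sums of gap k are exactly k, so perturbing it in two ways whose prefix sums cross
-- produces two losing coalitions that trade against gap k, gap k.
module Trades {m n k} (weighted : IsWeightedMajority m n (WinningH∀ m k))
  (nondecreasing : Nondecreasing m k) (gap≤n : ∀ t → 1 ≤ t → t ≤ m → gap k t ≤ n t) where

  perturb : (ℕ → ℕ) → (ℕ → ℕ) → ℕ → ℕ
  perturb X Y t = X t + gap k t ∸ Y t

  Σ₁-gap≡k : ∀ s → 1 ≤ s → s ≤ m → Σ₁ (gap k) s ≡ k s
  Σ₁-gap≡k (suc s) _ s<m = Σ₁-gap nondecreasing (suc s) s<m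

  gap-wins : WinningH∀ m k (gap k)
  gap-wins s 1≤s s≤m = ℕP.≤-reflexive (sym (Σ₁-gap≡k s 1≤s s≤m))

  perturb-loses : ∀ X Y → (∀ t → 1 ≤ t → t ≤ m → Y t ≤ X t + gap k t) →
    ∀ {s} → 1 ≤ s → s ≤ m → Σ₁ X s < Σ₁ Y s → ¬ WinningH∀ m k (perturb X Y)
  perturb-loses X Y Y≤X+gap {s} 1≤s s≤m ΣX<ΣY wins = ℕP.<-irrefl refl (begin-strict
    k s + Σ₁ Y s                        ≤⟨ ℕP.+-monoˡ-≤ (Σ₁ Y s) (wins s 1≤s s≤m) ⟩
    Σ₁ (perturb X Y) s + Σ₁ Y s         ≡⟨ Σ₁-∸ (λ t → X t + gap k t) Y s
                                             (λ t 1≤t t≤s → Y≤X+gap t 1≤t (ℕP.≤-trans t≤s s≤m)) ⟩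
    Σ₁ (λ t → X t + gap k t) s          ≡⟨ Σ₁-+ X (gap k) s ⟩
    Σ₁ X s + Σ₁ (gap k) s               ≡⟨ cong (Σ₁ X s +_) (Σ₁-gap≡k s 1≤s s≤m) ⟩
    Σ₁ X s + k s                        <⟨ ℕP.+-monoˡ-< (k s) ΣX<ΣY ⟩
    Σ₁ Y s + k s                        ≡⟨ ℕP.+-comm (Σ₁ Y s) (k s) ⟩
    k s + Σ₁ Y s                        ∎)
    where open ℕP.≤-Reasoning

  crossingPerturbations-⊥ : ∀ M P → (∀ t → 1 ≤ t → t ≤ m → Admissible n k (M t) t × Admissible n k (P t) t) →
    ∀ {s₁ s₂} → 1 ≤ s₁ → s₁ ≤ m → Σ₁ P s₁ < Σ₁ M s₁ → 1 ≤ s₂ → s₂ ≤ m → Σ₁ M s₂ < Σ₁ P s₂ → ⊥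
  crossingPerturbations-⊥ M P admissible 1≤s₁ s₁≤m ΣP<ΣM 1≤s₂ s₂≤m ΣM<ΣP =
    isWeightedMajority⇒tradeRobust weighted gap≤n
      (perturb-coalition P {M} (λ t 1≤t t≤m → proj₂ (proj₂ (admissible t 1≤t t≤m))))
      (perturb-coalition M {P} (λ t 1≤t t≤m → proj₂ (proj₁ (admissible t 1≤t t≤m))))
      (λ t 1≤t t≤m → ∸-balanced (M≤gap t 1≤t t≤m) (P≤gap t 1≤t t≤m))
      gap-wins
      (perturb-loses P M (λ t 1≤t t≤m → ℕP.≤-trans (M≤gap t 1≤t t≤m) (ℕP.m≤n+m _ (P t))) 1≤s₁ s₁≤m ΣP<ΣM)
      (perturb-loses M P (λ t 1≤t t≤m → ℕP.≤-trans (P≤gap t 1≤t t≤m) (ℕP.m≤n+m _ (M t))) 1≤s₂ s₂≤m ΣM<ΣP)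
    where
    M≤gap : ∀ t → 1 ≤ t → t ≤ m → M t ≤ gap k t
    P≤gap : ∀ t → 1 ≤ t → t ≤ m → P t ≤ gap k t
    M≤gap t 1≤t t≤m = proj₁ (proj₁ (admissible t 1≤t t≤m))
    P≤gap t 1≤t t≤m = proj₁ (proj₂ (admissible t 1≤t t≤m))
    perturb-coalition : ∀ X {Y} → (∀ t → 1 ≤ t → t ≤ m → X t + gap k t ≤ n t) → Coalition m n (perturb X Y)
    perturb-coalition X {Y} X+gap≤n t 1≤t t≤m = ℕP.≤-trans (ℕP.m∸n≤m _ (Y t)) (X+gap≤n t 1≤t t≤m)

  threeFlexibleLevels-⊥ : ∀ {i j l} → 1 ≤ i → i < j → j < l → l ≤ m →
    Flexible n k i → Flexible n k j → Flexible n k l → ⊥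
  threeFlexibleLevels-⊥ {i} {j} {l} 1≤i i<j j<l l≤m flexible-i flexible-j flexible-l =
    crossingPerturbations-⊥ (unitAt i) P
      (λ t 1≤t t≤m → unitAt-admissible flexible-i (gap≤n t 1≤t t≤m) ,
                     unitAt+unitAt-admissible j<l flexible-j flexible-l (gap≤n t 1≤t t≤m))
      1≤i i≤m ΣP<ΣM (ℕP.≤-trans 1≤i i≤l) l≤m ΣM<ΣP
    where
    P : ℕ → ℕ
    P t = unitAt j t + unitAt l t
    i≤l : i ≤ l
    i≤l = ℕP.<⇒≤ (ℕP.<-trans i<j j<l)
    i≤m : i ≤ m
    i≤m = ℕP.≤-trans i≤l l≤m
    ΣP<ΣM : Σ₁ P i < Σ₁ (unitAt i) i
    ΣP<ΣM rewrite Σ₁-+ (unitAt j) (unitAt l) i | Σ₁-unitAt-< i<j | Σ₁-unitAt-< (ℕP.<-trans i<j j<l)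
                | Σ₁-unitAt-≥ {s = i} 1≤i ℕP.≤-refl = ℕP.0<1+n
    ΣM<ΣP : Σ₁ (unitAt i) l < Σ₁ P l
    ΣM<ΣP rewrite Σ₁-+ (unitAt j) (unitAt l) l | Σ₁-unitAt-≥ (ℕP.≤-trans 1≤i (ℕP.<⇒≤ i<j)) (ℕP.<⇒≤ j<l)
                | Σ₁-unitAt-≥ {s = l} (ℕP.≤-trans 1≤i i≤l) ℕP.≤-refl | Σ₁-unitAt-≥ 1≤i i≤l = ℕP.≤-refl

  flexibleBeforeDoublyFlexible-⊥ : ∀ {i j} → 1 ≤ i → i < j → j ≤ m →
    Flexible n k i → DoublyFlexible n k j → ⊥
  flexibleBeforeDoublyFlexible-⊥ {i} {j} 1≤i i<j j≤m flexible-i doubly-flexible-j =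
    crossingPerturbations-⊥ (unitAt i) P
      (λ t 1≤t t≤m → unitAt-admissible flexible-i (gap≤n t 1≤t t≤m) ,
                     2×unitAt-admissible {n} {k} doubly-flexible-j (gap≤n t 1≤t t≤m))
      1≤i (ℕP.≤-trans (ℕP.<⇒≤ i<j) j≤m) ΣP<ΣM (ℕP.≤-trans 1≤i (ℕP.<⇒≤ i<j)) j≤m ΣM<ΣP
    where
    P : ℕ → ℕ
    P t = unitAt j t + unitAt j t
    ΣP<ΣM : Σ₁ P i < Σ₁ (unitAt i) i
    ΣP<ΣM rewrite Σ₁-+ (unitAt j) (unitAt j) i | Σ₁-unitAt-< i<j | Σ₁-unitAt-≥ {s = i} 1≤i ℕP.≤-refl = ℕP.0<1+n
    ΣM<ΣP : Σ₁ (unitAt i) j < Σ₁ P j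
    ΣM<ΣP rewrite Σ₁-+ (unitAt j) (unitAt j) j | Σ₁-unitAt-≥ {s = j} (ℕP.≤-trans 1≤i (ℕP.<⇒≤ i<j)) ℕP.≤-refl
                | Σ₁-unitAt-≥ 1≤i (ℕP.<⇒≤ i<j) = ℕP.≤-refl

-- Conditions (2) and (3) for a two-level game with thresholds a ≤ b and N players on level 2.
TwoLevelWeightable : ℕ → ℕ → ℕ → Set
TwoLevelWeightable a b N = b ≡ a + 1 ⊎ N + a ≡ b + 1

m≤n⇒n<m+o⇒n∸m<o : ∀ {m n o} → m ≤ n → n < m + o → n ∸ m < o
m≤n⇒n<m+o⇒n∸m<o {m} {n} {o} m≤n n<m+o =
  ℕP.+-cancelˡ-< m (n ∸ m) o (subst (_< m + o) (sym (ℕP.m+[n∸m]≡n m≤n)) n<m+o)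

gap-trichotomy : ∀ {a b N} → a < b → b < a + N → TwoLevelWeightable a b N ⊎ (2 ≤ b ∸ a × 2 + (b ∸ a) ≤ N)
gap-trichotomy {a} {b} {N} a<b b<a+N with b ∸ a ≟ 1 | suc (b ∸ a) ≟ N
... | yes b∸a≡1 | _ = inj₁ (inj₁ (trans (sym (ℕP.m+[n∸m]≡n (ℕP.<⇒≤ a<b))) (cong (a +_) b∸a≡1)))
... | no _ | yes 1+b∸a≡N = inj₁ (inj₂ (begin
  N + a             ≡⟨ cong (_+ a) 1+b∸a≡N ⟨
  suc (b ∸ a + a)   ≡⟨ cong suc (ℕP.m∸n+n≡m (ℕP.<⇒≤ a<b)) ⟩
  suc b             ≡⟨ ℕP.+-comm 1 b ⟩
  b + 1             ∎))
  where open ≡-Reasoning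
... | no b∸a≢1 | no 1+b∸a≢N =
  inj₂ (ℕP.≤∧≢⇒< (ℕP.m<n⇒0<n∸m a<b) (λ 1≡b∸a → b∸a≢1 (sym 1≡b∸a)) ,
        ℕP.≤∧≢⇒< (m≤n⇒n<m+o⇒n∸m<o (ℕP.<⇒≤ a<b) b<a+N) 1+b∸a≢N)

hypotheses⇒nondecreasing : ∀ {m n k} → Hypotheses m n k → Nondecreasing m k
hypotheses⇒nondecreasing _ zero _ = z≤n
hypotheses⇒nondecreasing {m} (_ , _ , _ , increasing , last-nondecreasing , _) (suc t) t+2≤m
  with suc (suc t) ≟ m
... | yes refl     = last-nondecreasing (s≤s (s≤s z≤n))
... | no  t+2≢m   = ℕP.<⇒≤ (increasing (suc t) (s≤s z≤n) (ℕP.≤∧≢⇒< t+2≤m t+2≢m))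

hypotheses⇒gap≤n : ∀ {m n k} → Hypotheses m n k → ∀ t → 1 ≤ t → t ≤ m → gap k t ≤ n t
hypotheses⇒gap≤n (_ , _ , _ , _ , _ , k₁≤n₁ , _) (suc zero) _ _ = k₁≤n₁
hypotheses⇒gap≤n h@(_ , _ , _ , _ , _ , _ , bounded-steps) (suc (suc t)) _ t+2≤m =
  ℕP.<⇒≤ (m≤n⇒n<m+o⇒n∸m<o (hypotheses⇒nondecreasing h (suc t) t+2≤m)
                            (bounded-steps (2 + t) (s≤s (s≤s z≤n)) t+2≤m))

steppingLevel-flexible : ∀ {m n k} → Hypotheses m n k → ∀ {t} → 2 ≤ t → t ≤ m → k (t ∸ 1) < k t →
  Flexible n k t
steppingLevel-flexible (_ , _ , _ , _ , _ , _ , bounded-steps) 2≤t@(s≤s (s≤s z≤n)) t≤m step =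
  ℕP.m<n⇒0<n∸m step , m≤n⇒n<m+o⇒n∸m<o (ℕP.<⇒≤ step) (bounded-steps _ 2≤t t≤m)

innerLevel-flexible : ∀ {m n k} → Hypotheses m n k → ∀ {t} → 2 ≤ t → t < m → Flexible n k t
innerLevel-flexible h@(_ , _ , _ , increasing , _) 2≤t@(s≤s (s≤s z≤n)) t<m =
  steppingLevel-flexible h 2≤t (ℕP.<⇒≤ t<m) (increasing _ (s≤s z≤n) t<m)

firstLevel-full-or-flexible : ∀ {m n k} → Hypotheses m n k → k 1 ≡ n 1 ⊎ Flexible n k 1
firstLevel-full-or-flexible {n = n} {k} (1≤m , _ , k≥1 , _ , _ , k₁≤n₁ , _) with k 1 ≟ n 1
... | yes k₁≡n₁ = inj₁ k₁≡n₁
... | no  k₁≢n₁ = inj₂ (k≥1 1 ℕP.≤-refl 1≤m , ℕP.≤∧≢⇒< k₁≤n₁ k₁≢n₁)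

steppingLevel-trichotomy : ∀ {m n k} → Hypotheses m n k → ∀ {t} → 2 ≤ t → t ≤ m → k (t ∸ 1) < k t →
  TwoLevelWeightable (k (t ∸ 1)) (k t) (n t) ⊎ DoublyFlexible n k t
steppingLevel-trichotomy (_ , _ , _ , _ , _ , _ , bounded-steps) 2≤t@(s≤s (s≤s z≤n)) t≤m step =
  gap-trichotomy step (bounded-steps _ 2≤t t≤m)

lastThreshold-rises : ∀ {m n k} → Hypotheses m n k → 2 ≤ m → k m ≢ k (m ∸ 1) → k (m ∸ 1) < k m
lastThreshold-rises (_ , _ , _ , _ , last-nondecreasing , _) 2≤m kₘ≢kₘ₋₁ =
  ℕP.≤∧≢⇒< (last-nondecreasing 2≤m) (λ kₘ₋₁≡kₘ → kₘ≢kₘ₋₁ (sym kₘ₋₁≡kₘ))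

module Necessity {m n k} (h : Hypotheses m n k) (weighted : IsWeightedMajority m n (WinningH∀ m k)) where
  open Trades weighted (hypotheses⇒nondecreasing h) (hypotheses⇒gap≤n h) public

  twoLevels : 2 ≤ m → k 1 < k 2 → Cond1to4 2 n k
  twoLevels 2≤m k₁<k₂ with steppingLevel-trichotomy h ℕP.≤-refl 2≤m k₁<k₂
  ... | inj₁ (inj₁ k₂≡k₁+1)     = inj₂ (inj₁ (refl , k₂≡k₁+1))
  ... | inj₁ (inj₂ n₂+k₁≡k₂+1) = inj₂ (inj₂ (inj₁ (refl , n₂+k₁≡k₂+1)))
  ... | inj₂ doubly-flexible-2 with firstLevel-full-or-flexible h
  ...   | inj₁ k₁≡n₁     = inj₂ (inj₂ (inj₂ (k₁≡n₁ , inj₁ refl)))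
  ...   | inj₂ flexible-1 =
    ⊥-elim (flexibleBeforeDoublyFlexible-⊥ ℕP.≤-refl ℕP.≤-refl 2≤m flexible-1 doubly-flexible-2)

  threeLevels : 3 ≤ m → k 2 < k 3 → Cond4 3 n k
  threeLevels 3≤m k₂<k₃ = firstLevel-full , inj₂ (refl , thirdLevel-weightable)
    where
    flexible-2 : Flexible n k 2
    flexible-2 = innerLevel-flexible h ℕP.≤-refl 3≤m
    firstLevel-full : k 1 ≡ n 1
    firstLevel-full with firstLevel-full-or-flexible h
    ... | inj₁ k₁≡n₁     = k₁≡n₁
    ... | inj₂ flexible-1 =
      ⊥-elim (threeFlexibleLevels-⊥ ℕP.≤-refl ℕP.≤-refl ℕP.≤-refl 3≤m
                flexible-1 flexible-2 (steppingLevel-flexible h (s≤s (s≤s z≤n)) 3≤m k₂<k₃))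
    thirdLevel-weightable : TwoLevelWeightable (k 2) (k 3) (n 3)
    thirdLevel-weightable with steppingLevel-trichotomy h (s≤s (s≤s z≤n)) 3≤m k₂<k₃
    ... | inj₁ weightable         = weightable
    ... | inj₂ doubly-flexible-3 =
      ⊥-elim (flexibleBeforeDoublyFlexible-⊥ (s≤s z≤n) ℕP.≤-refl 3≤m flexible-2 doubly-flexible-3)

necessity : ∀ m n k → Hypotheses m n k → IsWeightedMajority m n (WinningH∀ m k) → Cond1to4 m n k ⊎ Cond5 m n k
necessity 0 _ _ (() , _) _
necessity 1 _ _ _ _ = inj₁ (inj₁ refl)
necessity 2 n k h weighted with k 2 ≟ k 1
... | yes k₂≡k₁ = inj₂ (inj₁ refl , k₂≡k₁ , inj₁ refl)
... | no  k₂≢k₁ = inj₁ (twoLevels ℕP.≤-refl (lastThreshold-rises h ℕP.≤-refl k₂≢k₁))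
  where open Necessity h weighted
necessity 3 n k h@(_ , _ , _ , increasing , _) weighted with k 3 ≟ k 2
... | yes k₃≡k₂ =
  inj₂ (inj₂ (inj₁ refl) , k₃≡k₂ , twoLevels (s≤s (s≤s z≤n)) (increasing 1 ℕP.≤-refl ℕP.≤-refl))
  where open Necessity h weighted
... | no  k₃≢k₂ =
  inj₁ (inj₂ (inj₂ (inj₂ (threeLevels ℕP.≤-refl (lastThreshold-rises h (s≤s (s≤s z≤n)) k₃≢k₂)))))
  where open Necessity h weighted
necessity 4 n k h@(_ , _ , _ , increasing , _) weighted with k 4 ≟ k 3
... | yes k₄≡k₃ = inj₂ (inj₂ (inj₂ refl) , k₄≡k₃ ,
                    inj₂ (inj₂ (inj₂ (threeLevels (s≤s (s≤s (s≤s z≤n))) (increasing 2 (s≤s z≤n) ℕP.≤-refl)))))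
  where open Necessity h weighted
... | no  k₄≢k₃ = ⊥-elim (threeFlexibleLevels-⊥ (s≤s z≤n) ℕP.≤-refl ℕP.≤-refl ℕP.≤-refl
                    (innerLevel-flexible h ℕP.≤-refl (s≤s (s≤s (s≤s z≤n))))
                    (innerLevel-flexible h (s≤s (s≤s z≤n)) ℕP.≤-refl)
                    (steppingLevel-flexible h (s≤s (s≤s z≤n)) ℕP.≤-refl
                      (lastThreshold-rises h (s≤s (s≤s z≤n)) k₄≢k₃)))
  where open Necessity h weighted
necessity (suc (suc (suc (suc (suc _))))) n k h weighted =
  ⊥-elim (threeFlexibleLevels-⊥ (s≤s z≤n) ℕP.≤-refl ℕP.≤-refl (s≤s (s≤s (s≤s (s≤s z≤n))))
           (innerLevel-flexible h ℕP.≤-refl (s≤s (s≤s (s≤s z≤n))))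
           (innerLevel-flexible h (s≤s (s≤s z≤n)) (s≤s (s≤s (s≤s (s≤s z≤n)))))
           (innerLevel-flexible h (s≤s (s≤s z≤n)) (s≤s (s≤s (s≤s (s≤s (s≤s z≤n)))))))
  where open Necessity h weighted

-- Sufficiency

TwoLevelWeighted : ℕ → ℕ → ℕ → Set
TwoLevelWeighted a b N = Σ ℕ λ u → Σ ℕ λ v → Σ ℕ λ Q → ∀ x y → y ≤ N →
  ((a ≤ x × b ≤ x + y) ⇔ (Q ≤ u * x + v * (x + y)))

twoLevelWeighted-intro : ∀ {a b N} u v →
  (∀ {x y} → y ≤ N → x < a → u * x + v * (x + y) < u * a + v * b) →
  (∀ {x y} → y ≤ N → a ≤ x → x + y < b → u * x + v * (x + y) < u * a + v * b) →
  TwoLevelWeighted a b N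
twoLevelWeighted-intro {a} {b} u v below-a below-b = u , v , u * a + v * b , λ x y y≤N → mk⇔
  (λ (a≤x , b≤x+y) → ℕP.+-mono-≤ (ℕP.*-monoʳ-≤ u a≤x) (ℕP.*-monoʳ-≤ v b≤x+y))
  (λ Q≤weight → let a≤x = ℕP.≮⇒≥ (λ x<a → ℕP.<⇒≱ (below-a y≤N x<a) Q≤weight) in
     a≤x , ℕP.≮⇒≥ (λ x+y<b → ℕP.<⇒≱ (below-b y≤N a≤x x+y<b) Q≤weight))

adjacentThresholds-twoLevelWeighted : ∀ a N → TwoLevelWeighted a (a + 1) N
adjacentThresholds-twoLevelWeighted a N = twoLevelWeighted-intro N 1 below-a below-b
  where
  open ℕP.≤-Reasoning
  regroup : ∀ N x → N * x + (x + N) ≡ N * suc x + x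
  regroup = solve-∀
  below-a : ∀ {x y} → y ≤ N → x < a → N * x + 1 * (x + y) < N * a + 1 * (a + 1)
  below-a {x} {y} y≤N x<a = begin-strict
    N * x + 1 * (x + y)    ≡⟨ cong (N * x +_) (ℕP.*-identityˡ (x + y)) ⟩
    N * x + (x + y)        ≤⟨ ℕP.+-monoʳ-≤ (N * x) (ℕP.+-monoʳ-≤ x y≤N) ⟩
    N * x + (x + N)        ≡⟨ regroup N x ⟩
    N * suc x + x          <⟨ ℕP.+-mono-≤-< (ℕP.*-monoʳ-≤ N x<a) (ℕP.≤-trans x<a (ℕP.m≤m+n a 1)) ⟩
    N * a + (a + 1)        ≡⟨ cong (N * a +_) (ℕP.*-identityˡ (a + 1)) ⟨
    N * a + 1 * (a + 1)    ∎
  below-b : ∀ {x y} → y ≤ N → a ≤ x → x + y < a + 1 → N * x + 1 * (x + y) < N * a + 1 * (a + 1)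
  below-b {x} {y} _ _ x+y<a+1 = begin-strict
    N * x + 1 * (x + y)    ≡⟨ cong (N * x +_) (ℕP.*-identityˡ (x + y)) ⟩
    N * x + (x + y)        ≤⟨ ℕP.+-monoˡ-≤ (x + y) (ℕP.*-monoʳ-≤ N (ℕP.≤-trans (ℕP.m≤m+n x y) x+y≤a)) ⟩
    N * a + (x + y)        <⟨ ℕP.+-monoʳ-< (N * a) x+y<a+1 ⟩
    N * a + (a + 1)        ≡⟨ cong (N * a +_) (ℕP.*-identityˡ (a + 1)) ⟨
    N * a + 1 * (a + 1)    ∎
    where
    x+y≤a : x + y ≤ a
    x+y≤a = ℕP.≤-pred (subst (suc (x + y) ≤_) (ℕP.+-comm a 1) x+y<a+1)

tightSecondLevel-twoLevelWeighted : ∀ a d → TwoLevelWeighted a (a + d) (suc d)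
tightSecondLevel-twoLevelWeighted a d = twoLevelWeighted-intro 1 d below-a below-b
  where
  open ℕP.≤-Reasoning
  below-a : ∀ {x y} → y ≤ suc d → x < a → 1 * x + d * (x + y) < 1 * a + d * (a + d)
  below-a {x} {y} y≤1+d x<a = begin-strict
    1 * x + d * (x + y)    ≤⟨ ℕP.+-monoʳ-≤ (1 * x) (ℕP.*-monoʳ-≤ d x+y≤a+d) ⟩
    1 * x + d * (a + d)    <⟨ ℕP.+-monoˡ-< (d * (a + d)) (ℕP.*-monoʳ-< 1 x<a) ⟩
    1 * a + d * (a + d)    ∎
    where
    x+y≤a+d : x + y ≤ a + d
    x+y≤a+d = begin
      x + y                ≤⟨ ℕP.+-monoʳ-≤ x y≤1+d ⟩
      x + suc d            ≡⟨ ℕP.+-suc x d ⟩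
      suc x + d            ≤⟨ ℕP.+-monoˡ-≤ d x<a ⟩
      a + d                ∎
  below-b : ∀ {x y} → y ≤ suc d → a ≤ x → x + y < a + d → 1 * x + d * (x + y) < 1 * a + d * (a + d)
  below-b {x} {y} _ _ x+y<a+d = ℕP.≤-<-trans (ℕP.+-monoˡ-≤ (d * (x + y)) 1*x≤x+y)
    (ℕP.+-cancelʳ-≤ d _ _ (begin
      suc (x + y + d * (x + y)) + d  ≡⟨ expand (x + y) d ⟩
      suc d * suc (x + y)            ≤⟨ ℕP.*-monoʳ-≤ (suc d) x+y<a+d ⟩
      suc d * (a + d)                ≡⟨ collect a d ⟩
      1 * a + d * (a + d) + d        ∎))
    where
    1*x≤x+y : 1 * x ≤ x + y
    1*x≤x+y = subst (_≤ x + y) (sym (ℕP.*-identityˡ x)) (ℕP.m≤m+n x y)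
    expand : ∀ s d → suc (s + d * s) + d ≡ suc d * suc s
    expand = solve-∀
    collect : ∀ a d → suc d * (a + d) ≡ 1 * a + d * (a + d) + d
    collect = solve-∀

twoLevelWeightable⇒twoLevelWeighted : ∀ {a b N} → a ≤ b → TwoLevelWeightable a b N → TwoLevelWeighted a b N
twoLevelWeightable⇒twoLevelWeighted {a} {N = N} _ (inj₁ refl) = adjacentThresholds-twoLevelWeighted a N
twoLevelWeightable⇒twoLevelWeighted {a} {b} {N} a≤b (inj₂ N+a≡b+1) =
  subst₂ (TwoLevelWeighted a) (ℕP.m+[n∸m]≡n a≤b) 1+d≡N (tightSecondLevel-twoLevelWeighted a (b ∸ a))
  where
  1+d≡N : suc (b ∸ a) ≡ N
  1+d≡N = ℕP.+-cancelʳ-≡ a (suc (b ∸ a)) N (begin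
    suc (b ∸ a + a)  ≡⟨ cong suc (ℕP.m∸n+n≡m a≤b) ⟩
    suc b            ≡⟨ ℕP.+-comm 1 b ⟩
    b + 1            ≡⟨ N+a≡b+1 ⟨
    N + a            ∎)
    where open ≡-Reasoning

twoLevelWeightable-∸ : ∀ {a b c N} → c ≤ a → a ≤ b → TwoLevelWeightable a b N →
  TwoLevelWeightable (a ∸ c) (b ∸ c) N
twoLevelWeightable-∸ {a} {b} {c} c≤a _ (inj₁ b≡a+1) = inj₁ (trans (cong (_∸ c) b≡a+1) (ℕP.+-∸-comm 1 c≤a))
twoLevelWeightable-∸ {a} {b} {c} {N} c≤a a≤b (inj₂ N+a≡b+1) = inj₂ (begin
  N + (a ∸ c)   ≡⟨ ℕP.+-∸-assoc N c≤a ⟨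
  N + a ∸ c     ≡⟨ cong (_∸ c) N+a≡b+1 ⟩
  b + 1 ∸ c     ≡⟨ ℕP.+-∸-comm 1 (ℕP.≤-trans c≤a a≤b) ⟩
  b ∸ c + 1     ∎)
  where open ≡-Reasoning

oneLevel-isNatWeighted : ∀ n k → IsNatWeighted 1 n (WinningH∀ 1 k)
oneLevel-isNatWeighted n k = (λ _ → 1) , k 1 , λ ℓ _ → mk⇔
  (λ wins → subst (k 1 ≤_) (sym (ℕP.*-identityʳ (ℓ 1))) (wins 1 ℕP.≤-refl ℕP.≤-refl))
  (λ { k₁≤ℓ₁ (suc zero) _ _ → subst (k 1 ≤_) (ℕP.*-identityʳ (ℓ 1)) k₁≤ℓ₁
      ; _ (suc (suc _)) _ (s≤s ()) })

twoLevel-isNatWeighted : ∀ n k → TwoLevelWeighted (k 1) (k 2) (n 2) → IsNatWeighted 2 n (WinningH∀ 2 k)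
twoLevel-isNatWeighted n k (u , v , Q , represents) = w , Q , λ ℓ ℓ-coalition →
  let prefixSums = represents (ℓ 1) (ℓ 2) (ℓ-coalition 2 (s≤s z≤n) ℕP.≤-refl)
      weight≡ = regroup (ℓ 1) (ℓ 2) u v in mk⇔
  (λ wins → subst (Q ≤_) weight≡ (to prefixSums (wins 1 ℕP.≤-refl (s≤s z≤n) , wins 2 (s≤s z≤n) ℕP.≤-refl)))
  (λ Q≤weight → let (k₁≤ℓ₁ , k₂≤ℓ₁+ℓ₂) = from prefixSums (subst (Q ≤_) (sym weight≡) Q≤weight) in
     λ { (suc zero) _ _ → k₁≤ℓ₁ ; (suc (suc zero)) _ _ → k₂≤ℓ₁+ℓ₂ ; (suc (suc (suc _))) _ (s≤s (s≤s ())) })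
  where
  w : ℕ → ℕ
  w 1 = u + v
  w 2 = v
  w _ = 0
  regroup : ∀ x y u v → u * x + v * (x + y) ≡ x * (u + v) + y * v
  regroup = solve-∀

WinningH∀-suc : ∀ m k ℓ → WinningH∀ (suc m) k ℓ ⇔
  (k 1 ≤ ℓ 1 × (∀ i → 1 ≤ i → i ≤ m → k (suc i) ≤ ℓ 1 + Σ₁ (λ t → ℓ (suc t)) i))
WinningH∀-suc m k ℓ = mk⇔
  (λ wins → wins 1 ℕP.≤-refl (s≤s z≤n) ,
            λ i _ i≤m → subst (k (suc i) ≤_) (Σ₁-suc ℓ i) (wins (suc i) (s≤s z≤n) (s≤s i≤m)))
  λ { (k₁≤ℓ₁ , _) (suc zero) _ _ → k₁≤ℓ₁
    ; (_ , later) (suc (suc i)) _ (s≤s i+1≤m) →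
        subst (k (2 + i) ≤_) (sym (Σ₁-suc ℓ (suc i))) (later (suc i) (s≤s z≤n) i+1≤m) }

-- Each first-level member weighs more than everything else (R ≤ B), so missing one cannot be compensated.
vetoWeight : ∀ {x N R B Q} {P : Set} → x ≤ N → R ≤ B → (N ≤ x → (P ⇔ (Q ≤ R))) →
  (N ≤ x × P) ⇔ (suc B * N + Q ≤ suc B * x + R)
vetoWeight {x} {N} {R} {B} {Q} x≤N R≤B P⇔Q≤R = mk⇔
  (λ (N≤x , p) → subst (λ z → suc B * N + Q ≤ suc B * z + R) (ℕP.≤-antisym N≤x x≤N)
                   (ℕP.+-monoʳ-≤ (suc B * N) (to (P⇔Q≤R N≤x) p)))
  (λ Q′≤weight → let N≤x = ℕP.≮⇒≥ (λ x<N → ℕP.<⇒≱ (below x<N) Q′≤weight) in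
     N≤x , from (P⇔Q≤R N≤x) (ℕP.+-cancelˡ-≤ (suc B * N) Q R
             (subst (λ z → suc B * N + Q ≤ suc B * z + R) (ℕP.≤-antisym x≤N N≤x) Q′≤weight)))
  where
  open ℕP.≤-Reasoning
  *-suc′ : ∀ u x → u * x + u ≡ u * suc x
  *-suc′ = solve-∀
  below : x < N → suc B * x + R < suc B * N + Q
  below x<N = begin-strict
    suc B * x + R        ≤⟨ ℕP.+-monoʳ-≤ (suc B * x) R≤B ⟩
    suc B * x + B        <⟨ ℕP.+-monoʳ-< (suc B * x) (ℕP.n<1+n B) ⟩
    suc B * x + suc B    ≡⟨ *-suc′ (suc B) x ⟩
    suc B * suc x        ≤⟨ ℕP.*-monoʳ-≤ (suc B) x<N ⟩
    suc B * N            ≤⟨ ℕP.m≤m+n (suc B * N) Q ⟩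
    suc B * N + Q        ∎

∸-≤⇔≤-+ : ∀ c a y → (c ∸ a ≤ y) ⇔ (c ≤ a + y)
∸-≤⇔≤-+ c a y = mk⇔ (λ c∸a≤y → ℕP.≤-trans (ℕP.m≤n+m∸n c a) (ℕP.+-monoʳ-≤ a c∸a≤y)) (ℕP.m≤n+o⇒m∸n≤o c a)

-- With k₁ = n₁ every first-level player is a vetoer; the remaining levels form H∀((n₂,…),(k₂ − n₁,…)).
fullFirstLevel-isNatWeighted : ∀ m n k → k 1 ≡ n 1 →
  IsNatWeighted m (λ i → n (suc i)) (WinningH∀ m (λ i → k (suc i) ∸ n 1)) →
  IsNatWeighted (suc m) n (WinningH∀ (suc m) k)
fullFirstLevel-isNatWeighted m n k k₁≡n₁ (w , q , represents) = w′ , suc B * n 1 + q , λ ℓ ℓ-coalition →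
  let ℓ₁≤n₁ = ℓ-coalition 1 ℕP.≤-refl (s≤s z≤n)
      tail-coalition = λ i _ i≤m → ℓ-coalition (suc i) (s≤s z≤n) (s≤s i≤m)
      laterLevels⇔ : n 1 ≤ ℓ 1 → LaterLevelsWin ℓ ⇔ (q ≤ laterWeight ℓ)
      laterLevels⇔ n₁≤ℓ₁ = ⇔.trans
        (mk⇔ (λ wins i 1≤i i≤m → from (∸-≤⇔≤-+ (k (suc i)) (ℓ 1) _) (wins i 1≤i i≤m))
             (λ wins i 1≤i i≤m → to (∸-≤⇔≤-+ (k (suc i)) (ℓ 1) _) (wins i 1≤i i≤m)))
        (subst (λ z → WinningH∀ m (λ i → k (suc i) ∸ z) (λ i → ℓ (suc i)) ⇔ (q ≤ laterWeight ℓ))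
               (ℕP.≤-antisym n₁≤ℓ₁ ℓ₁≤n₁) (represents (λ i → ℓ (suc i)) tail-coalition))
  in begin
    WinningH∀ (suc m) k ℓ
      ≈⟨ WinningH∀-suc m k ℓ ⟩
    (k 1 ≤ ℓ 1 × LaterLevelsWin ℓ)
      ≡⟨ cong (λ z → z ≤ ℓ 1 × LaterLevelsWin ℓ) k₁≡n₁ ⟩
    (n 1 ≤ ℓ 1 × LaterLevelsWin ℓ)
      ≈⟨ vetoWeight ℓ₁≤n₁ (laterWeight≤B ℓ tail-coalition) laterLevels⇔ ⟩
    (suc B * n 1 + q ≤ suc B * ℓ 1 + laterWeight ℓ)
      ≡⟨ cong (suc B * n 1 + q ≤_) (sym (weight≡ ℓ)) ⟩
    (suc B * n 1 + q ≤ Σ₁ (λ i → ℓ i * w′ i) (suc m))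
      ∎
  where
  open ≈-Reasoning (⇔-setoid 0ℓ)
  LaterLevelsWin : (ℕ → ℕ) → Set
  LaterLevelsWin ℓ = ∀ i → 1 ≤ i → i ≤ m → k (suc i) ≤ ℓ 1 + Σ₁ (λ t → ℓ (suc t)) i
  laterWeight : (ℕ → ℕ) → ℕ
  laterWeight ℓ = Σ₁ (λ i → ℓ (suc i) * w i) m
  B : ℕ
  B = laterWeight n
  w′ : ℕ → ℕ
  w′ 0             = 0
  w′ 1             = suc B
  w′ (suc (suc i)) = w (suc i)
  laterWeight≤B : ∀ ℓ → Coalition m (λ i → n (suc i)) (λ i → ℓ (suc i)) → laterWeight ℓ ≤ B
  laterWeight≤B ℓ tail-coalition = Σ₁-mono-≤ m λ i 1≤i i≤m → ℕP.*-monoˡ-≤ (w i) (tail-coalition i 1≤i i≤m)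
  weight≡ : ∀ ℓ → Σ₁ (λ i → ℓ i * w′ i) (suc m) ≡ suc B * ℓ 1 + laterWeight ℓ
  weight≡ ℓ = trans (Σ₁-suc (λ i → ℓ i * w′ i) m)
    (cong₂ _+_ (ℕP.*-comm (ℓ 1) (suc B)) (Σ₁-cong m λ { (suc i) _ _ → refl }))

truncateAt : ℕ → (ℕ → ℕ) → ℕ → ℕ
truncateAt m w i with i ≤? m
... | yes _ = w i
... | no  _ = 0

truncateAt-≤ : ∀ {m} w {i} → i ≤ m → truncateAt m w i ≡ w i
truncateAt-≤ {m} w {i} i≤m with i ≤? m
... | yes _   = refl
... | no  i≰m = ⊥-elim (i≰m i≤m)

truncateAt-suc : ∀ m w → truncateAt m w (suc m) ≡ 0
truncateAt-suc m w with suc m ≤? m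
... | yes 1+m≤m = ⊥-elim (ℕP.<-irrefl refl 1+m≤m)
... | no  _     = refl

repeatedLastThreshold-isNatWeighted : ∀ m n k → 1 ≤ m → k (suc m) ≡ k m →
  IsNatWeighted m n (WinningH∀ m k) → IsNatWeighted (suc m) n (WinningH∀ (suc m) k)
repeatedLastThreshold-isNatWeighted m n k 1≤m kₘ₊₁≡kₘ (w , q , represents) =
  truncateAt m w , q , λ ℓ ℓ-coalition →
  let represents-ℓ = represents ℓ (λ i 1≤i i≤m → ℓ-coalition i 1≤i (ℕP.m≤n⇒m≤1+n i≤m)) in mk⇔
  (λ wins → subst (q ≤_) (sym (weight≡ ℓ)) (to represents-ℓ λ i 1≤i i≤m → wins i 1≤i (ℕP.m≤n⇒m≤1+n i≤m)))
  (λ q≤weight → lastLevel-redundant ℓ (from represents-ℓ (subst (q ≤_) (weight≡ ℓ) q≤weight)))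
  where
  weight≡ : ∀ ℓ → Σ₁ (λ i → ℓ i * truncateAt m w i) (suc m) ≡ Σ₁ (λ i → ℓ i * w i) m
  weight≡ ℓ = begin
    Σ₁ (λ i → ℓ i * truncateAt m w i) m + ℓ (suc m) * truncateAt m w (suc m)
      ≡⟨ cong₂ _+_ (Σ₁-cong m λ i _ i≤m → cong (ℓ i *_) (truncateAt-≤ w i≤m))
                   (cong (ℓ (suc m) *_) (truncateAt-suc m w)) ⟩
    Σ₁ (λ i → ℓ i * w i) m + ℓ (suc m) * 0
      ≡⟨ cong (Σ₁ (λ i → ℓ i * w i) m +_) (ℕP.*-zeroʳ (ℓ (suc m))) ⟩
    Σ₁ (λ i → ℓ i * w i) m + 0
      ≡⟨ ℕP.+-identityʳ _ ⟩
    Σ₁ (λ i → ℓ i * w i) m ∎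
    where open ≡-Reasoning
  lastLevel-redundant : ∀ ℓ → WinningH∀ m k ℓ → WinningH∀ (suc m) k ℓ
  lastLevel-redundant ℓ wins i 1≤i i≤1+m with i ≟ suc m
  ... | yes refl = subst (_≤ Σ₁ ℓ m + ℓ (suc m)) (sym kₘ₊₁≡kₘ)
                     (ℕP.≤-trans (wins m 1≤m ℕP.≤-refl) (ℕP.m≤m+n (Σ₁ ℓ m) (ℓ (suc m))))
  ... | no  i≢1+m = wins i 1≤i (ℕP.≤-pred (ℕP.≤∧≢⇒< i≤1+m i≢1+m))

cond1to4⇒isNatWeighted : ∀ m n k → Nondecreasing m k → Cond1to4 m n k → IsNatWeighted m n (WinningH∀ m k)
cond1to4⇒isNatWeighted _ n k _ (inj₁ refl) = oneLevel-isNatWeighted n k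
cond1to4⇒isNatWeighted _ n k nondecreasing (inj₂ (inj₁ (refl , k₂≡k₁+1))) =
  twoLevel-isNatWeighted n k (twoLevelWeightable⇒twoLevelWeighted (nondecreasing 1 ℕP.≤-refl) (inj₁ k₂≡k₁+1))
cond1to4⇒isNatWeighted _ n k nondecreasing (inj₂ (inj₂ (inj₁ (refl , n₂+k₁≡k₂+1)))) =
  twoLevel-isNatWeighted n k (twoLevelWeightable⇒twoLevelWeighted (nondecreasing 1 ℕP.≤-refl) (inj₂ n₂+k₁≡k₂+1))
cond1to4⇒isNatWeighted _ n k _ (inj₂ (inj₂ (inj₂ (k₁≡n₁ , inj₁ refl)))) =
  fullFirstLevel-isNatWeighted 1 n k k₁≡n₁ (oneLevel-isNatWeighted _ _)
cond1to4⇒isNatWeighted _ n k nondecreasing (inj₂ (inj₂ (inj₂ (k₁≡n₁ , inj₂ (refl , weightable))))) =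
  fullFirstLevel-isNatWeighted 2 n k k₁≡n₁ (twoLevel-isNatWeighted _ _
    (twoLevelWeightable⇒twoLevelWeighted (ℕP.∸-monoˡ-≤ (n 1) k₂≤k₃)
      (twoLevelWeightable-∸ n₁≤k₂ k₂≤k₃ weightable)))
  where
  k₂≤k₃ : k 2 ≤ k 3
  k₂≤k₃ = nondecreasing 2 ℕP.≤-refl
  n₁≤k₂ : n 1 ≤ k 2
  n₁≤k₂ = subst (_≤ k 2) k₁≡n₁ (nondecreasing 1 (s≤s (s≤s z≤n)))

sufficiency : ∀ m n k → Hypotheses m n k → Cond1to4 m n k ⊎ Cond5 m n k → IsNatWeighted m n (WinningH∀ m k)
sufficiency zero _ _ (() , _) _
sufficiency m n k h (inj₁ conditions) = cond1to4⇒isNatWeighted m n k (hypotheses⇒nondecreasing h) conditions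
sufficiency (suc m) n k h (inj₂ (m+1∈234 , kₘ₊₁≡kₘ , conditions)) =
  repeatedLastThreshold-isNatWeighted m n k (1≤m m+1∈234) kₘ₊₁≡kₘ
    (cond1to4⇒isNatWeighted m n k (λ t t<m → hypotheses⇒nondecreasing h t (ℕP.m≤n⇒m≤1+n t<m)) conditions)
  where
  1≤m : suc m ≡ 2 ⊎ suc m ≡ 3 ⊎ suc m ≡ 4 → 1 ≤ m
  1≤m (inj₁ refl)        = s≤s z≤n
  1≤m (inj₂ (inj₁ refl)) = s≤s z≤n
  1≤m (inj₂ (inj₂ refl)) = s≤s z≤n

theorem9 : (m : ℕ) (n k : ℕ → ℕ) → Hypotheses m n k →
    (IsWeightedMajority m n (WinningH∀ m k) ⇔ (Cond1to4 m n k ⊎ Cond5 m n k))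
theorem9 m n k h = mk⇔
  (necessity m n k h)
  (λ conditions → isNatWeighted⇒isWeightedMajority (sufficiency m n k h conditions))
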